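{- Let $G=(V,E)$ be a connected graph whose number of vertices is divisible by $4$. Let $\{A,B\}$ be the unique minimum cut of $G$, let $\mathcal{C}=\{A_1,A_2,B_1,B_2\}$ be an organized partition of $\{A,B\}$ with associated value $D_{\mathcal{C}}$, and let $\{R,S\}$ be a second minimum cut, i.e. a bisection different from $\{A,B\}$ such that $E(R,S)\le E(X,Y)$ for every bisection $\{X,Y\}\neq\{A,B\}$. Then $$E(R,S)-E(A,B)\le D_{\mathcal{C}}+1.$$
   Context: For $X,Y\subseteq V$, $E(X,Y)$ denotes the number of edges of $G$ with one endpoint in $X$ and the other in $Y$. A cut (bisection) is a partition $\{A,B\}$ of $V$ with $|A|=|B|$; it is a minimum cut if $E(A,B)$ is minimum among all bisections. For a bisection $\{A,B\}$, define $$D_{\mathcal{C}}=\min\big\{E(\bar A_1,\bar A_2)+E(\bar B_1,\bar B_2)-E(\bar A_1,\bar B_1)-E(\bar A_2,\bar B_2)\big\},$$ the minimum taken over all decompositions $A=\bar A_1\cup \bar A_2$, $B=\bar B_1\cup\bar B_2$ into disjoint sets with $|\bar A_1|=|\bar A_2|$ and $|\bar B_1|=|\bar B_2|$. Any decomposition attaining this minimum is called an organized partition of $\{A,B\}$. -}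

module Defs where

open import Data.Nat using (ℕ; zero; suc)
open import Data.Bool using (Bool; true; false; _∧_; if_then_else_)
open import Data.Fin using (Fin)
open import Data.Fin.Subset using (Subset; ∣_∣; _∪_; _∩_; ∁; ⊥)
open import Data.Vec using (lookup)
open import Data.List using (List; map; allFin)
open import Data.Nat.ListAction using (sum)
open import Data.Sum using (_⊎_)
open import Data.Integer using (ℤ; +_; _-_)
open import Data.Product using (_×_; Σ; _,_)
open import Relation.Binary.PropositionalEquality using (_≡_)
open import Relation.Nullary using (¬_)

record Graph (n : ℕ) : Set where
  field
    adj   : Fin n → Fin n → Bool
    sym   : ∀ u v → adj u v ≡ adj v u
    irrefl : ∀ u → adj u u ≡ false
open Graph public

data Reach {n : ℕ} (G : Graph n) : Fin n → Fin n → Set where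
  here : ∀ {u} → Reach G u u
  step : ∀ {u v w} → adj G u v ≡ true → Reach G v w → Reach G u w

Connected : {n : ℕ} → Graph n → Set
Connected G = ∀ u v → Reach G u v

-- E(X,Y): number of edges with one endpoint in X and the other in Y
-- (counted as ordered pairs (u,v), u ∈ X, v ∈ Y, u ~ v; equals the number
-- of edges for disjoint X, Y, which is the only case used).
E : {n : ℕ} → Graph n → Subset n → Subset n → ℕ
E {n} G X Y =
  sum (map (λ u → sum (map (λ v →
        if lookup X u ∧ lookup Y v ∧ adj G u v then 1 else 0) (allFin n)))
      (allFin n))

PartitionOf : {n : ℕ} → Subset n → Subset n → Subset n → Set
PartitionOf Z X Y = (X ∪ Y ≡ Z) × (X ∩ Y ≡ ⊥)

Bisection : {n : ℕ} → Subset n → Subset n → Set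
Bisection {n} X Y = PartitionOf (∁ ⊥) X Y × (∣ X ∣ ≡ ∣ Y ∣)

SameCut : {n : ℕ} → Subset n → Subset n → Subset n → Subset n → Set
SameCut X Y A B = ((X ≡ A) × (Y ≡ B)) ⊎ ((X ≡ B) × (Y ≡ A))

MinCut : {n : ℕ} → Graph n → Subset n → Subset n → Set
MinCut G A B = Bisection A B ×
  (∀ X Y → Bisection X Y → E G A B Data.Nat.≤ E G X Y)
  where import Data.Nat

UniqueMinCut : {n : ℕ} → Graph n → Subset n → Subset n → Set
UniqueMinCut G A B = MinCut G A B × (∀ X Y → MinCut G X Y → SameCut X Y A B)

SecondMinCut : {n : ℕ} → Graph n → Subset n → Subset n → Subset n → Subset n → Set
SecondMinCut G A B R S = Bisection R S × ¬ SameCut R S A B ×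
  (∀ X Y → Bisection X Y → ¬ SameCut X Y A B → E G R S Data.Nat.≤ E G X Y)
  where import Data.Nat

Decomposition : {n : ℕ} → Subset n → Subset n →
  Subset n → Subset n → Subset n → Subset n → Set
Decomposition A B A₁ A₂ B₁ B₂ =
  PartitionOf A A₁ A₂ × PartitionOf B B₁ B₂ ×
  (∣ A₁ ∣ ≡ ∣ A₂ ∣) × (∣ B₁ ∣ ≡ ∣ B₂ ∣)

Dval : {n : ℕ} → Graph n → Subset n → Subset n → Subset n → Subset n → ℤ
Dval G A₁ A₂ B₁ B₂ =
  + (E G A₁ A₂ Data.Nat.+ E G B₁ B₂) - + E G A₁ B₁ - + E G A₂ B₂
  where import Data.Nat

Organized : {n : ℕ} → Graph n → Subset n → Subset n →
  Subset n → Subset n → Subset n → Subset n → Set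
Organized G A B A₁ A₂ B₁ B₂ =
  Decomposition A B A₁ A₂ B₁ B₂ ×
  (∀ A₁' A₂' B₁' B₂' → Decomposition A B A₁' A₂' B₁' B₂' →
     Dval G A₁ A₂ B₁ B₂ Data.Integer.≤ Dval G A₁' A₂' B₁' B₂')
  where import Data.Integer

module Submission where

open import Defs hiding (sym)
open import Data.Nat using (ℕ)
open import Data.Nat.Divisibility using (_∣_)
open import Data.Fin.Subset using (Subset)
open import Data.Integer using (+_; _-_; _+_; _≤_)

import Data.Nat as ℕ
import Data.Integer as ℤ
import Data.Integer.Properties as ℤP
open import Data.Integer.Tactic.RingSolver using (solve-∀)
open import Data.Nat.Properties using (+-identityʳ; +-suc; +-commutativeSemigroup)
open import Data.Bool using (Bool; true; false; _∧_; _∨_; if_then_else_)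
open import Data.Bool.Properties using (∧-comm; ∧-assoc)
open import Data.Fin using (Fin)
open import Data.Fin.Subset
  using (_∪_; _∩_; ∁; ∣_∣; _∈_; _⊆_; ⊥; outside; inside)
open import Data.Fin.Subset.Properties
  using ( ∣⊥∣≡0; ∣∁p∣≡n∸∣p∣; ⊥⊆; ⊆-antisym; p⊆p∪q; q⊆p∪q
        ; x∈p∩q⁺; x∈p∩q⁻; ∩-comm; ∩-distribˡ-∪; ∩-distribʳ-∪
        ; ∪-identityˡ; ∪-commutativeMonoid)
open import Algebra.Bundles using (CommutativeMonoid)
import Algebra.Properties.CommutativeSemigroup as CommSemigroupProperties
open import Data.Vec using ([]; _∷_; lookup; tail)
open import Data.Vec.Properties using (lookup-zipWith; lookup-replicate)
open import Data.List using (List; map; allFin)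
import Data.List as List
open import Data.List.Properties using (map-cong)
open import Data.Nat.ListAction using (sum)
open import Data.Sum using (inj₁; inj₂)
open import Data.Product using (_,_; proj₁; proj₂)
open import Relation.Binary.PropositionalEquality
open import Relation.Nullary using (¬_)

-- Given the minimum bisection {A,B} and any decomposition
-- A = A₁ ∪ A₂, B = B₁ ∪ B₂ into halves, "swap" the halves A₂ and B₁:
-- X = A₁ ∪ B₁, Y = A₂ ∪ B₂ is again a bisection.  Expanding the edge
-- counts over the four parts,
--     E(X,Y) - E(A,B) = E(A₁,A₂) + E(B₁,B₂) - E(A₁,B₁) - E(A₂,B₂) = D,
-- because the cross terms E(A₁,B₂), E(A₂,B₁) occur in both counts.
-- Unless the graph is empty, {X,Y} ≠ {A,B} (e.g. X = A would force
-- B₁ ⊆ A ∩ B = ∅, hence B = ∅), so the second minimum cut satisfies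
-- E(R,S) ≤ E(X,Y) = E(A,B) + D.  If the graph is empty, all bisections
-- coincide and there is no second minimum cut at all.  The
-- argument works for every decomposition, organized or not.

module _ {n : ℕ} where

  part₁⊆ : {Z X Y : Subset n} → PartitionOf Z X Y → X ⊆ Z
  part₁⊆ {Y = Y} (X∪Y≡Z , _) x∈X = subst (_ ∈_) X∪Y≡Z (p⊆p∪q Y x∈X)

  part₂⊆ : {Z X Y : Subset n} → PartitionOf Z X Y → Y ⊆ Z
  part₂⊆ {X = X} {Y} (X∪Y≡Z , _) x∈Y = subst (_ ∈_) X∪Y≡Z (q⊆p∪q X Y x∈Y)

  disjoint-mono : {P Q P′ Q′ : Subset n} → P ⊆ P′ → Q ⊆ Q′ →
    P′ ∩ Q′ ≡ ⊥ → P ∩ Q ≡ ⊥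
  disjoint-mono {P} {Q} P⊆P′ Q⊆Q′ P′∩Q′≡⊥ = ⊆-antisym inclusion ⊥⊆
    where
    inclusion : P ∩ Q ⊆ ⊥
    inclusion x∈P∩Q with x∈p∩q⁻ P Q x∈P∩Q
    ... | x∈P , x∈Q = subst (_ ∈_) P′∩Q′≡⊥ (x∈p∩q⁺ (P⊆P′ x∈P , Q⊆Q′ x∈Q))

  ⊆-disjoint⇒⊥ : {P X Y : Subset n} → P ⊆ X → P ⊆ Y → X ∩ Y ≡ ⊥ → P ≡ ⊥
  ⊆-disjoint⇒⊥ {P} P⊆X P⊆Y X∩Y≡⊥ =
    ⊆-antisym (λ x∈P → subst (_ ∈_) P∩P≡⊥ (x∈p∩q⁺ (x∈P , x∈P))) ⊥⊆
    where
    P∩P≡⊥ : P ∩ P ≡ ⊥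
    P∩P≡⊥ = disjoint-mono P⊆X P⊆Y X∩Y≡⊥

  ∪-disjoint : (P Q R S : Subset n) → P ∩ R ≡ ⊥ → P ∩ S ≡ ⊥ →
    Q ∩ R ≡ ⊥ → Q ∩ S ≡ ⊥ → (P ∪ Q) ∩ (R ∪ S) ≡ ⊥
  ∪-disjoint P Q R S PR PS QR QS = begin
    (P ∪ Q) ∩ (R ∪ S)                           ≡⟨ ∩-distribʳ-∪ (R ∪ S) P Q ⟩
    P ∩ (R ∪ S) ∪ Q ∩ (R ∪ S)                   ≡⟨ cong₂ _∪_ (∩-distribˡ-∪ P R S) (∩-distribˡ-∪ Q R S) ⟩
    (P ∩ R ∪ P ∩ S) ∪ (Q ∩ R ∪ Q ∩ S)           ≡⟨ cong₂ _∪_ (cong₂ _∪_ PR PS) (cong₂ _∪_ QR QS) ⟩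
    (⊥ ∪ ⊥) ∪ (⊥ ∪ ⊥)                           ≡⟨ cong₂ _∪_ (∪-identityˡ ⊥) (∪-identityˡ ⊥) ⟩
    ⊥ ∪ ⊥                                       ≡⟨ ∪-identityˡ ⊥ ⟩
    ⊥                                           ∎
    where open ≡-Reasoning

  ∪-interchange : (P Q R S : Subset n) → (P ∪ Q) ∪ (R ∪ S) ≡ (P ∪ R) ∪ (Q ∪ S)
  ∪-interchange = CommSemigroupProperties.interchange
    (CommutativeMonoid.commutativeSemigroup (∪-commutativeMonoid n))

∣∪∣-disjoint : {n : ℕ} (P Q : Subset n) → P ∩ Q ≡ ⊥ → ∣ P ∪ Q ∣ ≡ ∣ P ∣ ℕ.+ ∣ Q ∣
∣∪∣-disjoint []            []            _    = refl
∣∪∣-disjoint (inside ∷ P)  (inside ∷ Q)  ()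
∣∪∣-disjoint (inside ∷ P)  (outside ∷ Q) P∩Q≡⊥ =
  cong ℕ.suc (∣∪∣-disjoint P Q (cong tail P∩Q≡⊥))
∣∪∣-disjoint (outside ∷ P) (inside ∷ Q)  P∩Q≡⊥ =
  trans (cong ℕ.suc (∣∪∣-disjoint P Q (cong tail P∩Q≡⊥)))
        (sym (+-suc ∣ P ∣ ∣ Q ∣))
∣∪∣-disjoint (outside ∷ P) (outside ∷ Q) P∩Q≡⊥ =
  ∣∪∣-disjoint P Q (cong tail P∩Q≡⊥)

balanced-partition-empty : {n : ℕ} {Z X Y : Subset n} → PartitionOf Z X Y →
  ∣ X ∣ ≡ ∣ Y ∣ → X ≡ ⊥ → ∣ Z ∣ ≡ 0
balanced-partition-empty {n} {Z} {X} {Y} (X∪Y≡Z , X∩Y≡⊥) ∣X∣≡∣Y∣ X≡⊥ = begin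
  ∣ Z ∣              ≡⟨ cong ∣_∣ X∪Y≡Z ⟨
  ∣ X ∪ Y ∣          ≡⟨ ∣∪∣-disjoint X Y X∩Y≡⊥ ⟩
  ∣ X ∣ ℕ.+ ∣ Y ∣    ≡⟨ cong₂ ℕ._+_ ∣X∣≡0 (trans (sym ∣X∣≡∣Y∣) ∣X∣≡0) ⟩
  0                  ∎
  where
  open ≡-Reasoning
  ∣X∣≡0 : ∣ X ∣ ≡ 0
  ∣X∣≡0 = trans (cong ∣_∣ X≡⊥) (∣⊥∣≡0 n)

bisection-empty : {n : ℕ} {A B : Subset n} → Bisection A B → ∣ A ∣ ≡ 0 → n ≡ 0
bisection-empty {n} {A} {B} ((A∪B≡V , A∩B≡⊥) , ∣A∣≡∣B∣) ∣A∣≡0 = begin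
  n                  ≡⟨ cong (n ℕ.∸_) (∣⊥∣≡0 n) ⟨
  n ℕ.∸ ∣ ⊥ {n} ∣    ≡⟨ ∣∁p∣≡n∸∣p∣ (⊥ {n}) ⟨
  ∣ ∁ (⊥ {n}) ∣      ≡⟨ cong ∣_∣ A∪B≡V ⟨
  ∣ A ∪ B ∣          ≡⟨ ∣∪∣-disjoint A B A∩B≡⊥ ⟩
  ∣ A ∣ ℕ.+ ∣ B ∣    ≡⟨ cong₂ ℕ._+_ ∣A∣≡0 (trans (sym ∣A∣≡∣B∣) ∣A∣≡0) ⟩
  0                  ∎
  where open ≡-Reasoning

cuts-of-empty-graph : {n : ℕ} → n ≡ 0 → (R S A B : Subset n) → SameCut R S A B
cuts-of-empty-graph refl [] [] [] [] = inj₁ (refl , refl)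

module _ {a} {I : Set a} where

  sum-map-+ : (xs : List I) (f g : I → ℕ) →
    sum (map (λ x → f x ℕ.+ g x) xs) ≡ sum (map f xs) ℕ.+ sum (map g xs)
  sum-map-+ List.[]       f g = refl
  sum-map-+ (x List.∷ xs) f g = begin
    (f x ℕ.+ g x) ℕ.+ sum (map (λ y → f y ℕ.+ g y) xs)        ≡⟨ cong (f x ℕ.+ g x ℕ.+_) (sum-map-+ xs f g) ⟩
    (f x ℕ.+ g x) ℕ.+ (sum (map f xs) ℕ.+ sum (map g xs))    ≡⟨ +-interchange (f x) (g x) _ _ ⟩
    (f x ℕ.+ sum (map f xs)) ℕ.+ (g x ℕ.+ sum (map g xs))    ∎
    where
    open ≡-Reasoning
    +-interchange : ∀ p q r s → (p ℕ.+ q) ℕ.+ (r ℕ.+ s) ≡ (p ℕ.+ r) ℕ.+ (q ℕ.+ s)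
    +-interchange = CommSemigroupProperties.interchange +-commutativeSemigroup

  sum-map-cong : (xs : List I) {f g : I → ℕ} → (∀ x → f x ≡ g x) →
    sum (map f xs) ≡ sum (map g xs)
  sum-map-cong xs f≗g = cong sum (map-cong f≗g xs)

  sum-map-0 : (xs : List I) → sum (map (λ _ → 0) xs) ≡ 0
  sum-map-0 List.[]       = refl
  sum-map-0 (_ List.∷ xs) = sum-map-0 xs

sum-map-comm : ∀ {a b} {I : Set a} {J : Set b} (xs : List I) (ys : List J)
  (f : I → J → ℕ) →
  sum (map (λ x → sum (map (f x) ys)) xs) ≡ sum (map (λ y → sum (map (λ x → f x y) xs)) ys)
sum-map-comm List.[]       ys f = sym (sum-map-0 ys)
sum-map-comm (x List.∷ xs) ys f = begin
  sum (map (f x) ys) ℕ.+ sum (map (λ x′ → sum (map (f x′) ys)) xs)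
    ≡⟨ cong (sum (map (f x) ys) ℕ.+_) (sum-map-comm xs ys f) ⟩
  sum (map (f x) ys) ℕ.+ sum (map (λ y → sum (map (λ x′ → f x′ y) xs)) ys)
    ≡⟨ sum-map-+ ys (f x) (λ y → sum (map (λ x′ → f x′ y) xs)) ⟨
  sum (map (λ y → f x y ℕ.+ sum (map (λ x′ → f x′ y) xs)) ys)
    ∎
  where open ≡-Reasoning

𝟙 : Bool → ℕ
𝟙 b = if b then 1 else 0

𝟙-∨-disjoint : (x y r : Bool) → x ∧ y ≡ false →
  𝟙 ((x ∨ y) ∧ r) ≡ 𝟙 (x ∧ r) ℕ.+ 𝟙 (y ∧ r)
𝟙-∨-disjoint true  true  r ()
𝟙-∨-disjoint true  false r _ = sym (+-identityʳ (𝟙 r))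
𝟙-∨-disjoint false y     r _ = refl

module _ {n : ℕ} (G : Graph n) where

  -- The double sum over all ordered pairs of vertices; E G X Y is the
  -- double sum of the indicator of "u ∈ X, v ∈ Y, u ~ v".
  ΣΣ : (Fin n → Fin n → ℕ) → ℕ
  ΣΣ f = sum (map (λ u → sum (map (f u) (allFin n))) (allFin n))

  ΣΣ-split : {f g h : Fin n → Fin n → ℕ} → (∀ u v → f u v ≡ g u v ℕ.+ h u v) →
    ΣΣ f ≡ ΣΣ g ℕ.+ ΣΣ h
  ΣΣ-split {f} {g} {h} f≡g+h = begin
    ΣΣ f
      ≡⟨ sum-map-cong (allFin n) (λ u → sum-map-cong (allFin n) (f≡g+h u)) ⟩
    sum (map (λ u → sum (map (λ v → g u v ℕ.+ h u v) (allFin n))) (allFin n))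
      ≡⟨ sum-map-cong (allFin n) (λ u → sum-map-+ (allFin n) (g u) (h u)) ⟩
    sum (map (λ u → sum (map (g u) (allFin n)) ℕ.+ sum (map (h u) (allFin n))) (allFin n))
      ≡⟨ sum-map-+ (allFin n) _ _ ⟩
    ΣΣ g ℕ.+ ΣΣ h
      ∎
    where open ≡-Reasoning

  lookup-disjoint : {X Y : Subset n} → X ∩ Y ≡ ⊥ → ∀ u → lookup X u ∧ lookup Y u ≡ false
  lookup-disjoint {X} {Y} X∩Y≡⊥ u = begin
    lookup X u ∧ lookup Y u   ≡⟨ lookup-zipWith _∧_ u X Y ⟨
    lookup (X ∩ Y) u          ≡⟨ cong (λ Z → lookup Z u) X∩Y≡⊥ ⟩
    lookup (⊥ {n}) u          ≡⟨ lookup-replicate u outside ⟩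
    false                     ∎
    where open ≡-Reasoning

  E-∪ˡ : (X Y Z : Subset n) → X ∩ Y ≡ ⊥ → E G (X ∪ Y) Z ≡ E G X Z ℕ.+ E G Y Z
  E-∪ˡ X Y Z X∩Y≡⊥ = ΣΣ-split λ u v →
    trans (cong (λ b → 𝟙 (b ∧ lookup Z v ∧ adj G u v)) (lookup-zipWith _∨_ u X Y))
          (𝟙-∨-disjoint (lookup X u) (lookup Y u) _ (lookup-disjoint X∩Y≡⊥ u))

  E-sym : (X Y : Subset n) → E G X Y ≡ E G Y X
  E-sym X Y = trans (sum-map-comm (allFin n) (allFin n) _)
    (sum-map-cong (allFin n) λ v → sum-map-cong (allFin n) λ u →
      cong 𝟙 (swap-∧ (lookup X u) (lookup Y v) (Graph.sym G u v)))
    where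
    swap-∧ : ∀ x y {r s} → r ≡ s → x ∧ y ∧ r ≡ y ∧ x ∧ s
    swap-∧ x y refl = begin
      x ∧ y ∧ _      ≡⟨ ∧-assoc x y _ ⟨
      (x ∧ y) ∧ _    ≡⟨ cong (_∧ _) (∧-comm x y) ⟩
      (y ∧ x) ∧ _    ≡⟨ ∧-assoc y x _ ⟩
      y ∧ x ∧ _      ∎
      where open ≡-Reasoning

  E-∪ʳ : (Z X Y : Subset n) → X ∩ Y ≡ ⊥ → E G Z (X ∪ Y) ≡ E G Z X ℕ.+ E G Z Y
  E-∪ʳ Z X Y X∩Y≡⊥ = begin
    E G Z (X ∪ Y)              ≡⟨ E-sym Z (X ∪ Y) ⟩
    E G (X ∪ Y) Z              ≡⟨ E-∪ˡ X Y Z X∩Y≡⊥ ⟩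
    E G X Z ℕ.+ E G Y Z        ≡⟨ cong₂ ℕ._+_ (E-sym X Z) (E-sym Y Z) ⟩
    E G Z X ℕ.+ E G Z Y        ∎
    where open ≡-Reasoning

  E-∪∪ : (P Q R S : Subset n) → P ∩ Q ≡ ⊥ → R ∩ S ≡ ⊥ →
    E G (P ∪ Q) (R ∪ S) ≡ (E G P R ℕ.+ E G P S) ℕ.+ (E G Q R ℕ.+ E G Q S)
  E-∪∪ P Q R S P∩Q≡⊥ R∩S≡⊥ = begin
    E G (P ∪ Q) (R ∪ S)                           ≡⟨ E-∪ˡ P Q (R ∪ S) P∩Q≡⊥ ⟩
    E G P (R ∪ S) ℕ.+ E G Q (R ∪ S)               ≡⟨ cong₂ ℕ._+_ (E-∪ʳ P R S R∩S≡⊥) (E-∪ʳ Q R S R∩S≡⊥) ⟩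
    (E G P R ℕ.+ E G P S) ℕ.+ (E G Q R ℕ.+ E G Q S) ∎
    where open ≡-Reasoning

-- Edges counted in both expressions cancel in their difference.
shared-terms-cancel : (p q r s c d : ℤ.ℤ) →
  ((p ℤ.+ c) ℤ.+ (d ℤ.+ q)) ℤ.- ((r ℤ.+ c) ℤ.+ (d ℤ.+ s)) ≡ (p ℤ.+ q) ℤ.- r ℤ.- s
shared-terms-cancel = solve-∀

module SwappedCut {n : ℕ} {A B A₁ A₂ B₁ B₂ : Subset n}
  (bisection : Bisection A B) (decomposition : Decomposition A B A₁ A₂ B₁ B₂) where

  private
    partitionA : PartitionOf A A₁ A₂
    partitionA = proj₁ decomposition
    partitionB : PartitionOf B B₁ B₂
    partitionB = proj₁ (proj₂ decomposition)
    ∣A₁∣≡∣A₂∣ : ∣ A₁ ∣ ≡ ∣ A₂ ∣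
    ∣A₁∣≡∣A₂∣ = proj₁ (proj₂ (proj₂ decomposition))
    ∣B₁∣≡∣B₂∣ : ∣ B₁ ∣ ≡ ∣ B₂ ∣
    ∣B₁∣≡∣B₂∣ = proj₂ (proj₂ (proj₂ decomposition))
    A∩B≡⊥ : A ∩ B ≡ ⊥
    A∩B≡⊥ = proj₂ (proj₁ bisection)

    cross-disjoint : {P Q : Subset n} → P ⊆ A → Q ⊆ B → P ∩ Q ≡ ⊥
    cross-disjoint P⊆A Q⊆B = disjoint-mono P⊆A Q⊆B A∩B≡⊥

    A₁∩B₁≡⊥ : A₁ ∩ B₁ ≡ ⊥
    A₁∩B₁≡⊥ = cross-disjoint (part₁⊆ partitionA) (part₁⊆ partitionB)
    A₂∩B₂≡⊥ : A₂ ∩ B₂ ≡ ⊥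
    A₂∩B₂≡⊥ = cross-disjoint (part₂⊆ partitionA) (part₂⊆ partitionB)

  X Y : Subset n
  X = A₁ ∪ B₁
  Y = A₂ ∪ B₂

  swapped-bisection : Bisection X Y
  swapped-bisection = (X∪Y≡V , X∩Y≡⊥) , ∣X∣≡∣Y∣
    where
    X∪Y≡V : X ∪ Y ≡ ∁ ⊥
    X∪Y≡V = trans (∪-interchange A₁ B₁ A₂ B₂)
      (trans (cong₂ _∪_ (proj₁ partitionA) (proj₁ partitionB)) (proj₁ (proj₁ bisection)))
    X∩Y≡⊥ : X ∩ Y ≡ ⊥
    X∩Y≡⊥ = ∪-disjoint A₁ B₁ A₂ B₂ (proj₂ partitionA)
      (cross-disjoint (part₁⊆ partitionA) (part₂⊆ partitionB))
      (trans (∩-comm B₁ A₂) (cross-disjoint (part₂⊆ partitionA) (part₁⊆ partitionB)))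
      (proj₂ partitionB)
    ∣X∣≡∣Y∣ : ∣ X ∣ ≡ ∣ Y ∣
    ∣X∣≡∣Y∣ = trans (∣∪∣-disjoint A₁ B₁ A₁∩B₁≡⊥)
      (trans (cong₂ ℕ._+_ ∣A₁∣≡∣A₂∣ ∣B₁∣≡∣B₂∣) (sym (∣∪∣-disjoint A₂ B₂ A₂∩B₂≡⊥)))

  -- The swapped cut differs from {A,B} unless there are no vertices:
  -- X = A forces B₁ ⊆ A ∩ B, and X = B forces A₁ ⊆ A ∩ B.
  swapped-differs : SameCut X Y A B → n ≡ 0
  swapped-differs (inj₁ (X≡A , _)) = bisection-empty bisection (trans ∣A∣≡∣B∣ ∣B∣≡0)
    where
    B₁⊆A : B₁ ⊆ A
    B₁⊆A = subst (B₁ ⊆_) X≡A (q⊆p∪q A₁ B₁)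
    ∣B∣≡0 : ∣ B ∣ ≡ 0
    ∣B∣≡0 = balanced-partition-empty partitionB ∣B₁∣≡∣B₂∣
      (⊆-disjoint⇒⊥ B₁⊆A (part₁⊆ partitionB) A∩B≡⊥)
    ∣A∣≡∣B∣ : ∣ A ∣ ≡ ∣ B ∣
    ∣A∣≡∣B∣ = proj₂ bisection
  swapped-differs (inj₂ (X≡B , _)) = bisection-empty bisection ∣A∣≡0
    where
    A₁⊆B : A₁ ⊆ B
    A₁⊆B = subst (A₁ ⊆_) X≡B (p⊆p∪q B₁)
    ∣A∣≡0 : ∣ A ∣ ≡ 0
    ∣A∣≡0 = balanced-partition-empty partitionA ∣A₁∣≡∣A₂∣
      (⊆-disjoint⇒⊥ (part₁⊆ partitionA) A₁⊆B A∩B≡⊥)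

  swap-gain : (G : Graph n) → + E G X Y - + E G A B ≡ Dval G A₁ A₂ B₁ B₂
  swap-gain G =
    trans (cong₂ (λ x y → + x - + y) E[X,Y] E[A,B])
          (shared-terms-cancel (+ E G A₁ A₂) (+ E G B₁ B₂) (+ E G A₁ B₁) (+ E G A₂ B₂)
                               (+ E G A₁ B₂) (+ E G A₂ B₁))
    where
    E[X,Y] : E G X Y ≡ (E G A₁ A₂ ℕ.+ E G A₁ B₂) ℕ.+ (E G A₂ B₁ ℕ.+ E G B₁ B₂)
    E[X,Y] = trans (E-∪∪ G A₁ B₁ A₂ B₂ A₁∩B₁≡⊥ A₂∩B₂≡⊥)
      (cong (λ e → (E G A₁ A₂ ℕ.+ E G A₁ B₂) ℕ.+ (e ℕ.+ E G B₁ B₂)) (E-sym G B₁ A₂))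
    E[A,B] : E G A B ≡ (E G A₁ B₁ ℕ.+ E G A₁ B₂) ℕ.+ (E G A₂ B₁ ℕ.+ E G A₂ B₂)
    E[A,B] = trans (cong₂ (E G) (sym (proj₁ partitionA)) (sym (proj₁ partitionB)))
      (E-∪∪ G A₁ A₂ B₁ B₂ (proj₂ partitionA) (proj₂ partitionB))

theorem6 : (n : ℕ) → 4 ∣ n → (G : Graph n) → Connected G →
    (A B : Subset n) → UniqueMinCut G A B →
    (A₁ A₂ B₁ B₂ : Subset n) → Organized G A B A₁ A₂ B₁ B₂ →
    (R S : Subset n) → SecondMinCut G A B R S →
    + E G R S - + E G A B ≤ Dval G A₁ A₂ B₁ B₂ + + 1
theorem6 n _ G _ A B ((bisectionAB , _) , _) A₁ A₂ B₁ B₂ (decomposition , _)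
         R S (_ , RS≢AB , RS-minimal) = begin
  + E G R S - + E G A B    ≤⟨ ℤP.+-monoˡ-≤ (ℤ.- + E G A B) (ℤ.+≤+ E[R,S]≤E[X,Y]) ⟩
  + E G X Y - + E G A B    ≡⟨ swap-gain G ⟩
  Dval G A₁ A₂ B₁ B₂       ≤⟨ ℤP.i≤i+j _ (+ 1) ⟩
  Dval G A₁ A₂ B₁ B₂ + + 1 ∎
  where
  open SwappedCut bisectionAB decomposition
  open ℤP.≤-Reasoning
  XY≢AB : ¬ SameCut X Y A B
  XY≢AB XY≡AB = RS≢AB (cuts-of-empty-graph (swapped-differs XY≡AB) R S A B)
  E[R,S]≤E[X,Y] : E G R S ℕ.≤ E G X Y
  E[R,S]≤E[X,Y] = RS-minimal X Y swapped-bisection XY≢AB
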